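{- In each of the two deduction systems DBL and DBL$_\ast$, for all formulas $\phi,\psi\in\mathcal{L}$ the sequent $\psi\times\phi,\ \phi\vee\psi\vdash\phi,\psi$ is derivable.
   Context: Fix a finite set $\Theta$ of atomic propositions and a distinguished $\theta_1\in\Theta$. The language $\mathcal{L}$ is the smallest set containing $\Theta$ such that $\neg\phi$, $\phi\rightarrow\psi$ and $(\psi|\phi)$ belong to $\mathcal{L}$ whenever $\phi,\psi\in\mathcal{L}$. Abbreviations: $\phi\vee\psi:=\neg\phi\rightarrow\psi$, $\phi\wedge\psi:=\neg(\neg\phi\vee\neg\psi)$, $\phi\leftrightarrow\psi:=(\phi\rightarrow\psi)\wedge(\psi\rightarrow\phi)$, $\psi\times\phi:=(\psi|\phi)\leftrightarrow\psi$, $\top:=\theta_1\rightarrow\theta_1$, $\bot:=\neg\top$. A sequent is a pair of finite (possibly empty) sequences $\Gamma,\Delta$ of formulas of $\mathcal{L}$, written $\Gamma\vdash\Delta$ (the right side lists alternatives: it is not the same as a single disjunction); "$\Gamma,\Delta$" denotes concatenation and $\{\Gamma\}$ the set of entries of $\Gamma$. The systems DBL and DBL$_\ast$ are the smallest sets of sequents $X$ satisfying, for all $\phi,\psi,\eta\in\mathcal{L}$ and finite sequences $\Gamma,\Delta,\Lambda,\Sigma$: (CUT) if $\Gamma\vdash\Delta,\phi$ and $\Lambda,\phi\vdash\Sigma$ are in $X$ then $\Gamma,\Lambda\vdash\Delta,\Sigma$ is in $X$; (STRUCT) if $\{\Gamma\}\subset\{\Lambda\}\cup\{\top\}$, $\{\Delta\}\subset\{\Sigma\}\cup\{\bot\}$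 and $\Gamma\vdash\Delta$ is in $X$ then $\Lambda\vdash\Sigma$ is in $X$; (modus ponens) $\phi,\phi\rightarrow\psi\vdash\psi$; (c1) $\vdash\phi\rightarrow(\psi\rightarrow\phi)$; (c2) $\vdash(\eta\rightarrow(\phi\rightarrow\psi))\rightarrow((\eta\rightarrow\phi)\rightarrow(\eta\rightarrow\psi))$; (c3) $\vdash(\neg\phi\rightarrow\neg\psi)\rightarrow((\neg\phi\rightarrow\psi)\rightarrow\phi)$; (b1) $\phi\rightarrow\psi\vdash\neg\phi,(\psi|\phi)$; (b2) $\vdash(\psi\rightarrow\eta|\phi)\rightarrow((\psi|\phi)\rightarrow(\eta|\phi))$; (b3) $\vdash(\psi|\phi)\rightarrow(\phi\rightarrow\psi)$; (b4) $\vdash\neg(\neg\psi|\phi)\leftrightarrow(\psi|\phi)$. DBL additionally contains (b5) $\psi\times\phi\vdash\phi\times\psi$. DBL$_\ast$ instead additionally contains (b5.weak.A) $\psi\times\neg\phi\vdash\psi\times\phi$ and $\psi\times\phi\vdash\psi\times\neg\phi$, and (b5.weak.B) $\psi\leftrightarrow\eta\vdash(\phi|\psi)\leftrightarrow(\phi|\eta)$. A sequent is derivable if it belongs to the system. -}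

module Defs where

open import Data.Nat using (ℕ)
open import Data.Fin using (Fin; zero)
open import Data.List using (List; []; _∷_; _++_; [_])
open import Data.List.Membership.Propositional using (_∈_)
open import Data.Sum using (_⊎_)
open import Relation.Binary.PropositionalEquality using (_≡_)

module Logic (n : ℕ) where

  data Form : Set where
    atom : Fin (ℕ.suc n) → Form
    ¬'_  : Form → Form
    _⇒_  : Form → Form → Form
    ⟨_∣_⟩ : Form → Form → Form

  infixr 5 _⇒_

  θ₁ : Form
  θ₁ = atom zero

  _∨'_ : Form → Form → Form
  φ ∨' ψ = (¬' φ) ⇒ ψ

  _∧'_ : Form → Form → Form
  φ ∧' ψ = ¬' ((¬' φ) ∨' (¬' ψ))

  _⇔'_ : Form → Form → Form
  φ ⇔' ψ = (φ ⇒ ψ) ∧' (ψ ⇒ φ)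

  _⊗_ : Form → Form → Form
  ψ ⊗ φ = ⟨ ψ ∣ φ ⟩ ⇔' ψ

  ⊤' : Form
  ⊤' = θ₁ ⇒ θ₁

  ⊥' : Form
  ⊥' = ¬' ⊤'

  data System : Set where
    DBL DBL∗ : System

  data Deriv (S : System) : List Form → List Form → Set where
    cut : ∀ {Γ Δ Λ Σ φ} → Deriv S Γ (Δ ++ [ φ ]) → Deriv S (Λ ++ [ φ ]) Σ →
          Deriv S (Γ ++ Λ) (Δ ++ Σ)
    struct : ∀ {Γ Δ Λ Σ} →
             (∀ {x} → x ∈ Γ → x ∈ Λ ⊎ x ≡ ⊤') →
             (∀ {x} → x ∈ Δ → x ∈ Σ ⊎ x ≡ ⊥') →
             Deriv S Γ Δ → Deriv S Λ Σ
    mp : ∀ {φ ψ} → Deriv S (φ ∷ (φ ⇒ ψ) ∷ []) [ ψ ]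
    c1 : ∀ {φ ψ} → Deriv S [] [ φ ⇒ (ψ ⇒ φ) ]
    c2 : ∀ {η φ ψ} → Deriv S [] [ (η ⇒ (φ ⇒ ψ)) ⇒ ((η ⇒ φ) ⇒ (η ⇒ ψ)) ]
    c3 : ∀ {φ ψ} → Deriv S [] [ ((¬' φ) ⇒ (¬' ψ)) ⇒ (((¬' φ) ⇒ ψ) ⇒ φ) ]
    b1 : ∀ {φ ψ} → Deriv S [ φ ⇒ ψ ] ((¬' φ) ∷ ⟨ ψ ∣ φ ⟩ ∷ [])
    b2 : ∀ {φ ψ η} → Deriv S [] [ ⟨ ψ ⇒ η ∣ φ ⟩ ⇒ (⟨ ψ ∣ φ ⟩ ⇒ ⟨ η ∣ φ ⟩) ]
    b3 : ∀ {φ ψ} → Deriv S [] [ ⟨ ψ ∣ φ ⟩ ⇒ (φ ⇒ ψ) ]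
    b4 : ∀ {φ ψ} → Deriv S [] [ (¬' ⟨ ¬' ψ ∣ φ ⟩) ⇔' ⟨ ψ ∣ φ ⟩ ]
    b5 : ∀ {φ ψ} → S ≡ DBL → Deriv S [ ψ ⊗ φ ] [ φ ⊗ ψ ]
    b5wA₁ : ∀ {φ ψ} → S ≡ DBL∗ → Deriv S [ ψ ⊗ (¬' φ) ] [ ψ ⊗ φ ]
    b5wA₂ : ∀ {φ ψ} → S ≡ DBL∗ → Deriv S [ ψ ⊗ φ ] [ ψ ⊗ (¬' φ) ]
    b5wB : ∀ {φ ψ η} → S ≡ DBL∗ → Deriv S [ ψ ⇔' η ] [ ⟨ φ ∣ ψ ⟩ ⇔' ⟨ φ ∣ η ⟩ ]

{-# OPTIONS --safe #-}
-- In both systems ψ × φ entails ψ × ¬φ: in DBL∗ this is (b5.weak.A), and in DBL one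
-- passes through φ × ψ by (b5), negates the conditioned formula using (b4), and applies (b5)
-- again.  Now (b1), applied to φ ∨ ψ = ¬φ → ψ, yields ¬¬φ or (ψ|¬φ); the first gives φ
-- classically, and the second gives ψ because ψ × ¬φ makes (ψ|¬φ) equivalent to ψ.
module Submission where

open import Defs
open import Data.Nat using (ℕ)
open import Data.List using (List; []; _∷_; [_])
open import Data.List.Membership.Propositional using (_∈_)
open import Data.List.Membership.Propositional.Properties using (∈-++⁻)
open import Data.List.Relation.Binary.Subset.Propositional using (_⊆_)
open import Data.List.Relation.Binary.Subset.Propositional.Properties using (⊆-refl; ⊆-reflexive-↭)
open import Data.List.Relation.Binary.Permutation.Propositional using (↭-refl; ↭-swap)
open import Data.List.Relation.Unary.Any using (here; there)
open import Data.Sum using (inj₁; reduce)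
open import Function using (_∘_)
open import Relation.Binary.PropositionalEquality using (refl)

module _ {n : ℕ} where
  open Logic n

  module Hilbert (S : System) where

    weaken : ∀ {Γ Λ Δ Σ} → Γ ⊆ Λ → Δ ⊆ Σ → Deriv S Γ Δ → Deriv S Λ Σ
    weaken Γ⊆Λ Δ⊆Σ = struct (inj₁ ∘ Γ⊆Λ) (inj₁ ∘ Δ⊆Σ)

    swap-conclusions : ∀ {Γ A B} → Deriv S Γ (A ∷ B ∷ []) → Deriv S Γ (B ∷ A ∷ [])
    swap-conclusions = weaken ⊆-refl (⊆-reflexive-↭ (↭-swap _ _ ↭-refl))

    infixr 9 _⨾_
    _⨾_ : ∀ {A B C} → Deriv S [ A ] [ B ] → Deriv S [ B ] [ C ] → Deriv S [ A ] [ C ]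
    _⨾_ = cut {Δ = []} {Λ = []}

    modus-ponens : ∀ {Γ A B} → Deriv S Γ [ A ⇒ B ] → Deriv S Γ [ A ] → Deriv S Γ [ B ]
    modus-ponens {Γ} {A} ⊢A⇒B ⊢A =
      weaken (reduce ∘ ∈-++⁻ Γ) ⊆-refl
        (cut {Δ = []} {Λ = Γ} ⊢A (cut {Δ = []} {Λ = [ A ]} ⊢A⇒B mp))

    ⇒-refl : ∀ {A} → Deriv S [] [ A ⇒ A ]
    ⇒-refl {A} = modus-ponens (modus-ponens (c2 {η = A} {φ = A ⇒ A}) c1) c1

    hypothesis : ∀ {Γ A} → A ∈ Γ → Deriv S Γ [ A ]
    hypothesis {A = A} A∈Γ =
      weaken (λ { (here refl) → A∈Γ }) ⊆-refl (cut {Δ = []} {Λ = [ A ]} ⇒-refl mp)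

    infix 4 _⊩_
    infixl 6 _·_

    data _⊩_ (Γ : List Form) : Form → Set where
      hyp : ∀ {A} → A ∈ Γ → Γ ⊩ A
      thm : ∀ {A} → Deriv S [] [ A ] → Γ ⊩ A
      _·_ : ∀ {A B} → Γ ⊩ A ⇒ B → Γ ⊩ A → Γ ⊩ B

    ⊩⇒Deriv : ∀ {Γ A} → Γ ⊩ A → Deriv S Γ [ A ]
    ⊩⇒Deriv (hyp A∈Γ) = hypothesis A∈Γ
    ⊩⇒Deriv (thm ⊢A)  = weaken (λ ()) ⊆-refl ⊢A
    ⊩⇒Deriv (f · a)   = modus-ponens (⊩⇒Deriv f) (⊩⇒Deriv a)

    hyp₀ : ∀ {Γ A} → A ∷ Γ ⊩ A
    hyp₀ = hyp (here refl)

    hyp₁ : ∀ {Γ A B} → B ∷ A ∷ Γ ⊩ A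
    hyp₁ = hyp (there (here refl))

    ⊩-mono : ∀ {Γ Λ A} → Γ ⊆ Λ → Γ ⊩ A → Λ ⊩ A
    ⊩-mono Γ⊆Λ (hyp A∈Γ) = hyp (Γ⊆Λ A∈Γ)
    ⊩-mono Γ⊆Λ (thm ⊢A)  = thm ⊢A
    ⊩-mono Γ⊆Λ (f · a)   = ⊩-mono Γ⊆Λ f · ⊩-mono Γ⊆Λ a

    ⊩-weaken : ∀ {Γ A B} → Γ ⊩ A → B ∷ Γ ⊩ A
    ⊩-weaken = ⊩-mono there

    deduction : ∀ {Γ A B} → A ∷ Γ ⊩ B → Γ ⊩ A ⇒ B
    deduction (hyp (here refl)) = thm ⇒-refl
    deduction (hyp (there B∈Γ)) = thm c1 · hyp B∈Γ
    deduction (thm ⊢B)          = thm c1 · thm ⊢B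
    deduction (f · a)           = thm c2 · deduction f · deduction a

    explosion : ∀ {Γ A B} → Γ ⊩ A → Γ ⊩ ¬' A → Γ ⊩ B
    explosion {B = B} a ¬a = thm (c3 {φ = B}) · (thm c1 · ¬a) · (thm c1 · a)

    by-contradiction : ∀ {Γ A B} → ¬' A ∷ Γ ⊩ B → ¬' A ∷ Γ ⊩ ¬' B → Γ ⊩ A
    by-contradiction {B = B} b ¬b = thm (c3 {ψ = B}) · deduction ¬b · deduction b

    ¬¬-elim : ∀ {Γ A} → Γ ⊩ ¬' ¬' A → Γ ⊩ A
    ¬¬-elim {A = A} ¬¬a = by-contradiction {B = ¬' A} hyp₀ (⊩-weaken ¬¬a)

    ¬-intro : ∀ {Γ A B} → A ∷ Γ ⊩ B → A ∷ Γ ⊩ ¬' B → Γ ⊩ ¬' A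
    ¬-intro b ¬b = by-contradiction (⊩-weaken (deduction b) · a) (⊩-weaken (deduction ¬b) · a)
      where a = ¬¬-elim hyp₀

    ¬¬-intro : ∀ {Γ A} → Γ ⊩ A → Γ ⊩ ¬' ¬' A
    ¬¬-intro {A = A} a = ¬-intro {B = A} (⊩-weaken a) hyp₀

    ∧-elimˡ : ∀ {Γ A B} → Γ ⊩ A ∧' B → Γ ⊩ A
    ∧-elimˡ {A = A} {B} a∧b =
      by-contradiction {B = ¬' ¬' A ⇒ ¬' B}
        (deduction (explosion (¬¬-elim hyp₀) hyp₁)) (⊩-weaken a∧b)

    ∧-elimʳ : ∀ {Γ A B} → Γ ⊩ A ∧' B → Γ ⊩ B
    ∧-elimʳ {A = A} {B} a∧b =
      by-contradiction {B = ¬' ¬' A ⇒ ¬' B} (thm c1 · hyp₀) (⊩-weaken a∧b)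

    ∧-intro : ∀ {Γ A B} → Γ ⊩ A → Γ ⊩ B → Γ ⊩ A ∧' B
    ∧-intro {B = B} a b = ¬-intro {B = B} (⊩-weaken b) (hyp₀ · ⊩-weaken (¬¬-intro a))

    ¬⇔-⇔-trans : ∀ {Γ A B C} → Γ ⊩ (¬' A) ⇔' B → Γ ⊩ B ⇔' C → Γ ⊩ A ⇔' (¬' C)
    ¬⇔-⇔-trans {A = A} {C = C} ¬a⇔b b⇔c = ∧-intro (deduction a⇒¬c) (deduction ¬c⇒a)
      where
        a⇒¬c : A ∷ _ ⊩ ¬' C
        a⇒¬c = ¬-intro {B = A} hyp₁
          (∧-elimʳ (⊩-weaken (⊩-weaken ¬a⇔b)) · (∧-elimʳ (⊩-weaken (⊩-weaken b⇔c)) · hyp₀))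
        ¬c⇒a : ¬' C ∷ _ ⊩ A
        ¬c⇒a = by-contradiction {B = C}
          (∧-elimˡ (⊩-weaken (⊩-weaken b⇔c)) · (∧-elimˡ (⊩-weaken (⊩-weaken ¬a⇔b)) · hyp₀))
          hyp₁

    ⊗-¬ˡ : ∀ {Γ φ ψ} → Γ ⊩ φ ⊗ ψ → Γ ⊩ (¬' φ) ⊗ ψ
    ⊗-¬ˡ = ¬⇔-⇔-trans (thm b4)

    ∨-⊗¬-elim : ∀ {φ ψ} → Deriv S (φ ∨' ψ ∷ ψ ⊗ (¬' φ) ∷ []) (φ ∷ ψ ∷ [])
    ∨-⊗¬-elim {φ} {ψ} =
      cut {Δ = [ φ ]} {Λ = [ ψ ⊗ (¬' φ) ]} φ-or-conditional
        (⊩⇒Deriv (∧-elimˡ hyp₀ · hyp₁))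
      where
        φ-or-conditional : Deriv S [ φ ∨' ψ ] (φ ∷ ⟨ ψ ∣ ¬' φ ⟩ ∷ [])
        φ-or-conditional = swap-conclusions
          (cut {Δ = [ ⟨ ψ ∣ ¬' φ ⟩ ]} {Λ = []} (swap-conclusions b1) (⊩⇒Deriv (¬¬-elim hyp₀)))

  ⊗-¬ʳ : ∀ S {φ ψ} → Deriv S [ ψ ⊗ φ ] [ ψ ⊗ (¬' φ) ]
  ⊗-¬ʳ DBL  = b5 refl ⨾ ⊩⇒Deriv (⊗-¬ˡ hyp₀) ⨾ b5 refl
    where open Hilbert DBL
  ⊗-¬ʳ DBL∗ = b5wA₂ refl

mainTheorem7 : (n : ℕ) → (S : Logic.System n) → (φ ψ : Logic.Form n) →
    Logic.Deriv n S (Logic._⊗_ n ψ φ ∷ Logic._∨'_ n φ ψ ∷ []) (φ ∷ ψ ∷ [])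
mainTheorem7 n S φ ψ = cut {Δ = []} {Λ = [ φ ∨' ψ ]} (⊗-¬ʳ S) ∨-⊗¬-elim
  where
    open Logic n
    open Hilbert S
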